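{- Let $q$ be a prime power and $k\ge 1$, $N,K,n$ positive integers. Let $\mathcal{C}\subseteq\mathbb{F}_{q^k}^N$ be an $[N,K,D]_{q^k}$ linear code with maximum weight $W:=w(\mathcal{C})$ such that $$\frac{D}{W}>\frac{q-1}{q},$$ and let $\mathcal{I}$ be an $[n,k,d]_q$ minimal code. Let $\pi:\mathbb{F}_{q^k}\to\mathbb{F}_q^n$ be an $\mathbb{F}_q$-linear injection with $\pi(\mathbb{F}_{q^k})=\mathcal{I}$. Then the concatenated code $\mathcal{I}\,\Box_\pi\,\mathcal{C}$ is a minimal code with parameters $[Nn,Kk,\ge Dd]_q$. Equivalently, the corresponding set of $Nn$ points in $\mathrm{PG}(Kk-1,q)$ (given by the columns of a generator matrix of $\mathcal{I}\,\Box_\pi\,\mathcal{C}$) is a strong blocking set of size $Nn$.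
   Context: For $v\in\mathbb{F}_q^n$, $\sigma(v)=\{i: v_i\neq 0\}$ is its support and $\mathrm{wt}(v)=|\sigma(v)|$. An $[n,k,d]_q$ code is a $k$-dimensional subspace of $\mathbb{F}_q^n$ with minimum nonzero weight $d$; its maximum weight is $w(\mathcal{C})=\max\{\mathrm{wt}(c):c\in\mathcal{C}\}$. A nonzero codeword $c$ is minimal if every nonzero codeword $c'$ with $\sigma(c')\subseteq\sigma(c)$ equals $\lambda c$ for some $\lambda\in\mathbb{F}_q^*$; a code is minimal if all its nonzero codewords are minimal. The concatenation is $\mathcal{I}\,\Box_\pi\,\mathcal{C}=\{(\pi(c_1),\dots,\pi(c_N)) : (c_1,\dots,c_N)\in\mathcal{C}\}\subseteq\mathbb{F}_q^{Nn}$. A set (or multiset) $\mathcal{M}$ of points of $\mathrm{PG}(m-1,q)$ is a strong blocking set if for every hyperplane $\mathcal{H}$, the points of $\mathcal{M}\cap\mathcal{H}$ span $\mathcal{H}$. The points corresponding to a code are the columns of a generator matrix viewed as projective points. -}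

module Defs where

open import Level using (0ℓ)
open import Data.Nat as ℕ using (ℕ; zero; suc)
open import Data.Fin using (Fin; remQuot)
open import Data.Fin.Base using (combine)
open import Data.List using (List; length; filter)
open import Data.List.Base using (allFin)
open import Data.Product using (Σ; ∃; ∃-syntax; _×_; _,_; proj₁; proj₂)
open import Relation.Binary.PropositionalEquality using (_≡_; _≢_)
open import Relation.Binary.Definitions using (DecidableEquality)
open import Relation.Nullary using (¬_; ¬?)
open import Algebra.Core using (Op₁; Op₂)
open import Algebra.Structures using (IsCommutativeRing)
open import Function.Bundles using (_↔_)
open import Data.Nat.Primality using (Prime)

record Field : Set₁ where
  infixl 7 _*_
  infixl 6 _+_
  field
    Carrier : Set
    _+_ _*_ : Op₂ Carrier
    -_      : Op₁ Carrier
    0# 1#   : Carrier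
    isCommutativeRing : IsCommutativeRing _≡_ _+_ _*_ -_ 0# 1#
    0≢1     : 0# ≢ 1#
    inverse : ∀ x → x ≢ 0# → ∃[ y ] (x * y ≡ 1#)
    _≟_     : DecidableEquality Carrier

HasSize : Field → ℕ → Set
HasSize F q = Field.Carrier F ↔ Fin q

IsPrimePower : ℕ → Set
IsPrimePower q = ∃[ p ] ∃[ e ] (Prime p × 1 ℕ.≤ e × q ≡ p ℕ.^ e)

record FieldEmbedding (F L : Field) : Set where
  private
    module F = Field F
    module L = Field L
  field
    ι      : F.Carrier → L.Carrier
    ι-+    : ∀ a b → ι (a F.+ b) ≡ ι a L.+ ι b
    ι-*    : ∀ a b → ι (a F.* b) ≡ ι a L.* ι b
    ι-0    : ι F.0# ≡ L.0#
    ι-1    : ι F.1# ≡ L.1#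

module Coding (F : Field) where
  open Field F

  Vec : ℕ → Set
  Vec n = Fin n → Carrier

  _≗ᵥ_ : ∀ {n} → Vec n → Vec n → Set
  u ≗ᵥ v = ∀ i → u i ≡ v i

  0ᵥ : ∀ {n} → Vec n
  0ᵥ _ = 0#

  _•_ : ∀ {n} → Carrier → Vec n → Vec n
  (a • v) i = a * v i

  sumF : ∀ {m} → (Fin m → Carrier) → Carrier
  sumF {zero}  f = 0#
  sumF {suc m} f = f Fin.zero + sumF (λ i → f (Fin.suc i))
    where import Data.Fin as Fin

  _·ₘ_ : ∀ {K N} → Vec K → (Fin K → Vec N) → Vec N
  (x ·ₘ G) j = sumF (λ i → x i * G i j)

  Code : ℕ → Set₁
  Code n = Vec n → Set

  -- C is an [n,k] linear code: it is the row space of a k × n generator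
  -- matrix G whose rows are linearly independent
  IsLinearCode : ∀ {n} → Code n → ℕ → Set
  IsLinearCode {n} C k =
    Σ (Fin k → Vec n) λ G →
        (∀ v → C v → ∃[ x ] (v ≗ᵥ (x ·ₘ G)))
      × (∀ x → C (x ·ₘ G))
      × (∀ (x : Vec k) → (x ·ₘ G) ≗ᵥ 0ᵥ → x ≗ᵥ 0ᵥ)

  InSupport : ∀ {n} → Vec n → Fin n → Set
  InSupport v i = v i ≢ 0#

  wt : ∀ {n} → Vec n → ℕ
  wt {n} v = length (filter (λ i → ¬? (v i ≟ 0#)) (allFin n))

  Nonzero : ∀ {n} → Vec n → Set
  Nonzero v = ¬ (v ≗ᵥ 0ᵥ)

  _⊆σ_ : ∀ {n} → Vec n → Vec n → Set
  u ⊆σ v = ∀ i → InSupport u i → InSupport v i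

  HasMinDistance : ∀ {n} → Code n → ℕ → Set
  HasMinDistance C d =
    (∃[ c ] (C c × Nonzero c × wt c ≡ d))
    × (∀ c → C c → Nonzero c → d ℕ.≤ wt c)

  HasMaxWeight : ∀ {n} → Code n → ℕ → Set
  HasMaxWeight C w =
    (∃[ c ] (C c × wt c ≡ w)) × (∀ c → C c → wt c ℕ.≤ w)

  IsMinimalCodeword : ∀ {n} → Code n → Vec n → Set
  IsMinimalCodeword C c =
    ∀ c′ → C c′ → Nonzero c′ → c′ ⊆σ c →
      ∃[ λ′ ] (λ′ ≢ 0# × c′ ≗ᵥ (λ′ • c))

  IsMinimalCode : ∀ {n} → Code n → Set
  IsMinimalCode C = ∀ c → C c → Nonzero c → IsMinimalCodeword C c

module Concat {F L : Field} (E : FieldEmbedding F L) where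
  private
    module F = Field F
    module L = Field L
    module CF = Coding F
    module CL = Coding L
  open FieldEmbedding E

  -- π : L → F^n is F-linear (L regarded as an F-vector space via ι)
  IsFLinear : ∀ {n} → (L.Carrier → CF.Vec n) → Set
  IsFLinear {n} π =
    (∀ x y → π (x L.+ y) CF.≗ᵥ λ i → π x i F.+ π y i)
    × (∀ a x → π (ι a L.* x) CF.≗ᵥ (a CF.• π x))

  IsInjective : ∀ {n} → (L.Carrier → CF.Vec n) → Set
  IsInjective π = ∀ x y → π x CF.≗ᵥ π y → x ≡ y

  HasImage : ∀ {n} → (L.Carrier → CF.Vec n) → CF.Code n → Set
  HasImage π I = (∀ v → I v → ∃[ x ] (v CF.≗ᵥ π x)) × (∀ x → I (π x))

  -- (π(c_1), …, π(c_N)), coordinate (j , l) ↦ π(c_j)_l,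
  -- with Fin (N * n) ≅ Fin N × Fin n via remQuot/combine
  concatWord : ∀ {N n} → (L.Carrier → CF.Vec n) → CL.Vec N → CF.Vec (N ℕ.* n)
  concatWord {N} {n} π c i with remQuot {N} n i
  ... | (j , l) = π (c j) l

  ConcatCode : ∀ {N n} → (L.Carrier → CF.Vec n) → CL.Code N → CF.Code (N ℕ.* n)
  ConcatCode π C v = ∃[ c ] (C c × v CF.≗ᵥ concatWord π c)

-- Pulling the rows of a generator matrix of I back along π gives an F-basis of L; multiplying
-- it into a generator matrix of C yields a generator matrix of I □_π C, whose words are the
-- blockwise π-images of the words of C.  Each nonzero block has weight at least d, so the
-- weights multiply to at least D d.
-- For minimality, let π(c′) have support inside π(c).  Blockwise, minimality of I and
-- injectivity of π give c′_j = μ_j c_j with μ_j ∈ F.  If c′ − t c ≠ 0 for each of the q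
-- scalars t ∈ F, these codewords have weight at least D each, while a coordinate j counts
-- towards at most q − 1 of them, and only if c_j ≠ 0; so q D ≤ (q − 1) wt c ≤ (q − 1) W,
-- contradicting D / W > (q − 1) / q.  Hence c′ = t c, and π(c′) = t π(c).

module Submission where

open import Level using (0ℓ)
open import Algebra.Bundles using (Monoid; CommutativeRing)
open import Data.Nat as ℕ using (ℕ; zero; suc; _∸_; _^_; _≤_; _<_; z≤n)
import Data.Nat.Properties as ℕₚ
open import Data.Fin using (Fin; zero; suc; _↑ˡ_; _↑ʳ_; combine; remQuot; punchIn)
open import Data.Fin.Properties using (remQuot-combine; combine-remQuot; any?; all?)
open import Data.Vec.Functional using (Vector)
open import Data.List using (length; filter; tabulate)
open import Data.Product using (∃-syntax; _×_; _,_; proj₁; proj₂; uncurry)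
open import Data.Empty using (⊥-elim)
open import Function using (_∘_; Inverse)
open import Relation.Nullary using (¬?; yes; no)
open import Relation.Nullary.Decidable using (decidable-stable)
open import Relation.Binary.PropositionalEquality
  using (_≡_; _≢_; refl; sym; trans; cong; cong₂; module ≡-Reasoning)
open import Defs

module MonoidSum {c ℓ} (M : Monoid c ℓ) where
  open Monoid M using (Carrier; _≈_; ∙-congˡ; identityˡ; assoc)
    renaming (_∙_ to _+_; refl to ≈-refl; sym to ≈-sym; trans to ≈-trans)
  open import Algebra.Properties.Monoid.Sum M using (sum)

  sum-↑ : ∀ m {n} (f : Vector Carrier (m ℕ.+ n)) →
          sum f ≈ sum (f ∘ (_↑ˡ n)) + sum (f ∘ (m ↑ʳ_))
  sum-↑ zero    f = ≈-sym (identityˡ _)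
  sum-↑ (suc m) f = ≈-trans (∙-congˡ (sum-↑ m (f ∘ suc))) (≈-sym (assoc _ _ _))

  sum-combine : ∀ m {n} (f : Vector Carrier (m ℕ.* n)) →
                sum f ≈ sum (λ i → sum (λ j → f (combine {m} {n} i j)))
  sum-combine zero        f = ≈-refl
  sum-combine (suc m) {n} f = ≈-trans (sum-↑ n f) (∙-congˡ (sum-combine m (f ∘ (n ↑ʳ_))))

module ℕ∑ where
  open import Algebra.Properties.Semiring.Sum ℕₚ.+-*-semiring public
  open MonoidSum ℕₚ.+-0-monoid public

  sum-mono-≤ : ∀ {m} {f g : Vector ℕ m} → (∀ i → f i ≤ g i) → sum f ≤ sum g
  sum-mono-≤ {zero}  f≤g = z≤n
  sum-mono-≤ {suc m} f≤g = ℕₚ.+-mono-≤ (f≤g zero) (sum-mono-≤ (f≤g ∘ suc))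

  sum-const : ∀ m c → sum {m} (λ _ → c) ≡ m ℕ.* c
  sum-const zero    c = refl
  sum-const (suc m) c = cong (c ℕ.+_) (sum-const m c)

  sum-≤1 : ∀ {m} {f : Vector ℕ m} → (∀ i → f i ≤ 1) → sum f ≤ m
  sum-≤1 {m} f≤1 =
    ℕₚ.≤-trans (sum-mono-≤ f≤1) (ℕₚ.≤-reflexive (trans (sum-const m 1) (ℕₚ.*-identityʳ m)))

  sum≤m∸1 : ∀ {m} {f : Vector ℕ m} (i : Fin m) → f i ≡ 0 → (∀ t → f t ≤ 1) → sum f ≤ m ∸ 1
  sum≤m∸1 {suc m} {f} i fi≡0 f≤1 = begin
    sum f                        ≡⟨ sum-remove f ⟩
    f i ℕ.+ sum (f ∘ punchIn i)  ≤⟨ ℕₚ.+-mono-≤ (ℕₚ.≤-reflexive fi≡0) (sum-≤1 (f≤1 ∘ punchIn i)) ⟩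
    m                            ∎
    where open ℕₚ.≤-Reasoning

commutativeRing : Field → CommutativeRing 0ℓ 0ℓ
commutativeRing F = record { isCommutativeRing = Field.isCommutativeRing F }

module FieldVectors (F : Field) where
  open Field F
  open Coding F
  open CommutativeRing (commutativeRing F)
    using (+-identityˡ; +-identityʳ; zeroˡ; distribʳ; *-assoc; *-identityˡ; +-monoid; ring; semiring)
  open import Algebra.Properties.Ring ring using (x∙y⁻¹≈ε⇒x≈y; -‿distribˡ-*)
  open import Algebra.Properties.Semiring.Sum semiring public
    using (sum; sum-cong-≗; ∑-distrib-+; *-distribˡ-sum; *-distribʳ-sum)
  open MonoidSum +-monoid public

  sumF≡sum : ∀ {m} (f : Vector Carrier m) → sumF f ≡ sum f
  sumF≡sum {zero}  f = refl
  sumF≡sum {suc m} f = cong (f zero +_) (sumF≡sum (f ∘ suc))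

  ·ₘ≡sum : ∀ {K N} (x : Vec K) (G : Fin K → Vec N) j → (x ·ₘ G) j ≡ sum (λ i → x i * G i j)
  ·ₘ≡sum x G j = sumF≡sum (λ i → x i * G i j)

  ·ₘ-congˡ : ∀ {K N} {x y : Vec K} (G : Fin K → Vec N) → x ≗ᵥ y → (x ·ₘ G) ≗ᵥ (y ·ₘ G)
  ·ₘ-congˡ {x = x} {y} G x≗y j = begin
    (x ·ₘ G) j               ≡⟨ ·ₘ≡sum x G j ⟩
    sum (λ i → x i * G i j)  ≡⟨ sum-cong-≗ (λ i → cong (_* G i j) (x≗y i)) ⟩
    sum (λ i → y i * G i j)  ≡⟨ ·ₘ≡sum y G j ⟨
    (y ·ₘ G) j               ∎
    where open ≡-Reasoning

  ·ₘ-linear : ∀ {K N} (x y : Vec K) a (G : Fin K → Vec N) j →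
              ((λ i → x i + a * y i) ·ₘ G) j ≡ (x ·ₘ G) j + a * (y ·ₘ G) j
  ·ₘ-linear x y a G j = begin
    ((λ i → x i + a * y i) ·ₘ G) j       ≡⟨ ·ₘ≡sum _ G j ⟩
    sum (λ i → (x i + a * y i) * G i j)  ≡⟨ sum-cong-≗ distribute ⟩
    sum (λ i → xG i + ayG i)             ≡⟨ ∑-distrib-+ xG ayG ⟩
    sum xG + sum ayG                     ≡⟨ cong₂ _+_ (·ₘ≡sum x G j) yG-scaled ⟨
    (x ·ₘ G) j + a * (y ·ₘ G) j          ∎
    where
    open ≡-Reasoning
    xG ayG : Vector Carrier _
    xG  i = x i * G i j
    ayG i = a * (y i * G i j)
    distribute : ∀ i → (x i + a * y i) * G i j ≡ xG i + ayG i
    distribute i =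
      trans (distribʳ (G i j) (x i) (a * y i)) (cong (xG i +_) (*-assoc a (y i) (G i j)))
    yG-scaled : a * (y ·ₘ G) j ≡ sum ayG
    yG-scaled = trans (cong (a *_) (·ₘ≡sum y G j)) (*-distribˡ-sum a (λ i → y i * G i j))

  ·ₘ-zeroˡ : ∀ {K N} (G : Fin K → Vec N) j → (0ᵥ ·ₘ G) j ≡ 0#
  ·ₘ-zeroˡ {zero}  G j = refl
  ·ₘ-zeroˡ {suc K} G j =
    trans (cong₂ _+_ (zeroˡ (G zero j)) (·ₘ-zeroˡ (G ∘ suc) j)) (+-identityˡ 0#)

  unit : ∀ {k} → Fin k → Vec k
  unit zero    zero    = 1#
  unit zero    (suc _) = 0#
  unit (suc _) zero    = 0#
  unit (suc t) (suc s) = unit t s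

  ·ₘ-unit : ∀ {k N} (G : Fin k → Vec N) t j → (unit t ·ₘ G) j ≡ G t j
  ·ₘ-unit G zero    j =
    trans (cong₂ _+_ (*-identityˡ (G zero j)) (·ₘ-zeroˡ (G ∘ suc) j)) (+-identityʳ _)
  ·ₘ-unit G (suc t) j =
    trans (cong₂ _+_ (zeroˡ (G zero j)) (·ₘ-unit (G ∘ suc) t j)) (+-identityˡ _)

  module LinearCode {n k} {C : Code n} (C-linear : IsLinearCode C k) where
    generator : Fin k → Vec n
    generator = proj₁ C-linear

    spans : ∀ v → C v → ∃[ x ] (v ≗ᵥ (x ·ₘ generator))
    spans = proj₁ (proj₂ C-linear)

    contains : ∀ x → C (x ·ₘ generator)
    contains = proj₁ (proj₂ (proj₂ C-linear))

    independent : ∀ x → (x ·ₘ generator) ≗ᵥ 0ᵥ → x ≗ᵥ 0ᵥ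
    independent = proj₂ (proj₂ (proj₂ C-linear))

  linearCode-closed : ∀ {n k} {C : Code n} → IsLinearCode C k → ∀ {u v} → C u → C v → ∀ a →
                      ∃[ w ] (C w × w ≗ᵥ (λ j → u j + a * v j))
  linearCode-closed (G , spans , contains , _) {u} {v} Cu Cv a with spans u Cu | spans v Cv
  ... | x , u≗xG | y , v≗yG =
    (λ i → x i + a * y i) ·ₘ G , contains _ ,
    λ j → trans (·ₘ-linear x y a G j) (sym (cong₂ (λ s t → s + a * t) (u≗xG j) (v≗yG j)))

  ≡-from-scaled-difference : ∀ x a y → x + (- a) * y ≡ 0# → x ≡ a * y
  ≡-from-scaled-difference x a y x-ay≡0 =
    x∙y⁻¹≈ε⇒x≈y x (a * y) (trans (cong (x +_) (-‿distribˡ-* a y)) x-ay≡0)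

  ⊆σ-zero : ∀ {n} {u v : Vec n} → u ⊆σ v → v ≗ᵥ 0ᵥ → u ≗ᵥ 0ᵥ
  ⊆σ-zero {u = u} u⊆v v≗0 i = decidable-stable (u i ≟ 0#) (λ ui≢0 → u⊆v i ui≢0 (v≗0 i))

  wt₁ : Carrier → ℕ
  wt₁ x with x ≟ 0#
  ... | yes _ = 0
  ... | no  _ = 1

  wt₁-0 : ∀ {x} → x ≡ 0# → wt₁ x ≡ 0
  wt₁-0 {x} x≡0 with x ≟ 0#
  ... | yes _   = refl
  ... | no  x≢0 = ⊥-elim (x≢0 x≡0)

  wt₁≤1 : ∀ x → wt₁ x ≤ 1
  wt₁≤1 x with x ≟ 0#
  ... | yes _ = z≤n
  ... | no  _ = ℕₚ.≤-refl

  wt≡sum-wt₁ : ∀ {n} (v : Vec n) → wt v ≡ ℕ∑.sum (wt₁ ∘ v)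
  wt≡sum-wt₁ v = count v (λ i → i)
    where
    count : ∀ {m n} (v : Vec n) (g : Fin m → Fin n) →
            length (filter (λ i → ¬? (v i ≟ 0#)) (tabulate g)) ≡ ℕ∑.sum (wt₁ ∘ v ∘ g)
    count {zero}  v g = refl
    count {suc m} v g with v (g zero) ≟ 0#
    ... | yes _ = count v (g ∘ suc)
    ... | no  _ = cong suc (count v (g ∘ suc))

  wt-cong : ∀ {n} {u v : Vec n} → u ≗ᵥ v → wt u ≡ wt v
  wt-cong {u = u} {v} u≗v =
    trans (wt≡sum-wt₁ u) (trans (ℕ∑.sum-cong-≗ (cong wt₁ ∘ u≗v)) (sym (wt≡sum-wt₁ v)))

module Concatenation {F L : Field} (E : FieldEmbedding F L) where
  private
    module F = Field F
    module L = Field L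
    module CF = Coding F
    module CL = Coding L
    module VF = FieldVectors F
    module VL = FieldVectors L
    module RF = CommutativeRing (commutativeRing F)
    module RL = CommutativeRing (commutativeRing L)
  open import Algebra.Properties.Ring RF.ring using (x+x≈x⇒x≈0)
  open FieldEmbedding E
  open Concat E

  concatWord-combine : ∀ {N n} (π : L.Carrier → CF.Vec n) (c : CL.Vec N) j l →
                       concatWord π c (combine j l) ≡ π (c j) l
  concatWord-combine {N} {n} π c j l =
    cong (λ (j′ , l′) → π (c j′) l′) (remQuot-combine {N} {n} j l)

  concatWord-cong : ∀ {N n} (π : L.Carrier → CF.Vec n) {c c′ : CL.Vec N} →
                    c CL.≗ᵥ c′ → concatWord π c CF.≗ᵥ concatWord π c′
  concatWord-cong {N} {n} π c≗c′ r =
    cong (λ x → π x (proj₂ (remQuot {N} n r))) (c≗c′ (proj₁ (remQuot {N} n r)))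

  concatWord-⊆σ : ∀ {N n} (π : L.Carrier → CF.Vec n) {c c′ : CL.Vec N} →
                  concatWord π c′ CF.⊆σ concatWord π c → ∀ j → π (c′ j) CF.⊆σ π (c j)
  concatWord-⊆σ π {c} {c′} c′⊆c j l πc′≢0 πc≡0 =
    c′⊆c (combine j l)
         (πc′≢0 ∘ trans (sym (concatWord-combine π c′ j l)))
         (trans (concatWord-combine π c j l) πc≡0)

  wt-concatWord : ∀ {N n} (π : L.Carrier → CF.Vec n) (c : CL.Vec N) →
                  CF.wt (concatWord π c) ≡ ℕ∑.sum (λ j → CF.wt (π (c j)))
  wt-concatWord {N} {n} π c = begin
    CF.wt (concatWord π c)                            ≡⟨ VF.wt≡sum-wt₁ (concatWord π c) ⟩
    ℕ∑.sum (VF.wt₁ ∘ concatWord π c)                  ≡⟨ ℕ∑.sum-combine N (VF.wt₁ ∘ concatWord π c) ⟩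
    ℕ∑.sum (λ j → ℕ∑.sum (λ l → wt₁-block j l))       ≡⟨ ℕ∑.sum-cong-≗ blockwise ⟩
    ℕ∑.sum (λ j → CF.wt (π (c j)))                    ∎
    where
    open ≡-Reasoning
    wt₁-block : Fin N → Fin n → ℕ
    wt₁-block j l = VF.wt₁ (concatWord π c (combine j l))
    blockwise : ∀ j → ℕ∑.sum (wt₁-block j) ≡ CF.wt (π (c j))
    blockwise j =
      trans (ℕ∑.sum-cong-≗ (cong VF.wt₁ ∘ concatWord-combine π c j)) (sym (VF.wt≡sum-wt₁ (π (c j))))

  -- The property of the outer code that makes every concatenation with a minimal inner code minimal.
  ScalarRigid : ∀ {N} → CL.Code N → Set
  ScalarRigid {N} C =
    ∀ {c c′} → C c → C c′ → (μ : Fin N → F.Carrier) → (∀ j → c′ j ≡ ι (μ j) L.* c j) →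
    ∃[ a ] (∀ j → c′ j ≡ ι a L.* c j)

  _⊖[_]_ : ∀ {N} → CL.Vec N → F.Carrier → CL.Vec N → CL.Vec N
  (c′ ⊖[ a ] c) j = c′ j L.+ (L.- ι a) L.* c j

  ⊖-coordinate : ∀ {x x′ μ} a → x′ ≡ ι μ L.* x → x′ L.+ (L.- ι a) L.* x ≡ (ι μ L.+ L.- ι a) L.* x
  ⊖-coordinate {x} {μ = μ} a x′≡μx =
    trans (cong (L._+ (L.- ι a) L.* x) x′≡μx) (sym (RL.distribʳ x (ι μ) (L.- ι a)))

  module _ {q} (F-size : HasSize F q) where
    open Inverse F-size using (to; from; strictlyInverseʳ)

    sum-wt-⊖≤ : ∀ {N} (c c′ : CL.Vec N) (μ : Fin N → F.Carrier) → (∀ j → c′ j ≡ ι (μ j) L.* c j) →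
                ℕ∑.sum (λ t → CL.wt (c′ ⊖[ from t ] c)) ≤ CL.wt c ℕ.* (q ∸ 1)
    sum-wt-⊖≤ {N} c c′ μ c′≡μc = begin
      ℕ∑.sum (λ t → CL.wt (shift t))                     ≡⟨ ℕ∑.sum-cong-≗ (VL.wt≡sum-wt₁ ∘ shift) ⟩
      ℕ∑.sum (λ t → ℕ∑.sum (λ j → VL.wt₁ (shift t j)))   ≡⟨ ℕ∑.∑-comm (λ t j → VL.wt₁ (shift t j)) ⟩
      ℕ∑.sum (λ j → ℕ∑.sum (λ t → VL.wt₁ (shift t j)))   ≤⟨ ℕ∑.sum-mono-≤ coordinate ⟩
      ℕ∑.sum (λ j → VL.wt₁ (c j) ℕ.* (q ∸ 1))            ≡⟨ ℕ∑.*-distribʳ-sum (q ∸ 1) (VL.wt₁ ∘ c) ⟨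
      ℕ∑.sum (VL.wt₁ ∘ c) ℕ.* (q ∸ 1)                     ≡⟨ cong (ℕ._* (q ∸ 1)) (VL.wt≡sum-wt₁ c) ⟨
      CL.wt c ℕ.* (q ∸ 1)                                 ∎
      where
      open ℕₚ.≤-Reasoning
      shift : Fin q → CL.Vec N
      shift t = c′ ⊖[ from t ] c
      coordinate : ∀ j → ℕ∑.sum (λ t → VL.wt₁ (shift t j)) ≤ VL.wt₁ (c j) ℕ.* (q ∸ 1)
      coordinate j with c j L.≟ L.0#
      ... | yes cj≡0 = ℕₚ.≤-reflexive (trans (ℕ∑.sum-cong-≗ (VL.wt₁-0 ∘ vanish)) (ℕ∑.sum-replicate-zero q))
        where
        vanish : ∀ t → shift t j ≡ L.0#
        vanish t = trans (⊖-coordinate (from t) (c′≡μc j)) (trans (cong (_ L.*_) cj≡0) (RL.zeroʳ _))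
      ... | no _ = ℕₚ.≤-trans (ℕ∑.sum≤m∸1 (to (μ j)) (VL.wt₁-0 vanish) (VL.wt₁≤1 ∘ _))
                              (ℕₚ.≤-reflexive (sym (ℕₚ.+-identityʳ _)))
        where
        vanish : shift (to (μ j)) j ≡ L.0#
        vanish =
          trans (⊖-coordinate (from (to (μ j))) (c′≡μc j))
                (trans (cong (λ a → (ι (μ j) L.+ L.- ι a) L.* c j) (strictlyInverseʳ (μ j)))
                       (trans (cong (L._* c j) (RL.-‿inverseʳ _)) (RL.zeroˡ _)))

    scalarRigid : ∀ {N K D W} {C : CL.Code N} → CL.IsLinearCode C K → CL.HasMinDistance C D →
                  CL.HasMaxWeight C W → (q ∸ 1) ℕ.* W < q ℕ.* D → ScalarRigid C
    scalarRigid {D = D} {W} C-linear C-dist C-maxWt ratio {c} {c′} Cc Cc′ μ c′≡μc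
      with any? (λ t → all? (λ j → (c′ ⊖[ from t ] c) j L.≟ L.0#))
    ... | yes (t , ⊖≡0) = from t , λ j → VL.≡-from-scaled-difference (c′ j) (ι (from t)) (c j) (⊖≡0 j)
    ... | no ¬⊖≡0 = ⊥-elim (ℕₚ.<⇒≱ ratio bound)
      where
      D≤wt-⊖ : ∀ t → D ≤ CL.wt (c′ ⊖[ from t ] c)
      D≤wt-⊖ t with VL.linearCode-closed C-linear Cc′ Cc (L.- ι (from t))
      ... | w , Cw , w≗⊖ = ℕₚ.≤-trans (proj₂ C-dist w Cw w≢0) (ℕₚ.≤-reflexive (VL.wt-cong w≗⊖))
        where
        w≢0 : CL.Nonzero w
        w≢0 w≗0 = ¬⊖≡0 (t , λ j → trans (sym (w≗⊖ j)) (w≗0 j))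
      bound : q ℕ.* D ≤ (q ∸ 1) ℕ.* W
      bound = begin
        q ℕ.* D                                 ≡⟨ ℕ∑.sum-const q D ⟨
        ℕ∑.sum {q} (λ _ → D)                    ≤⟨ ℕ∑.sum-mono-≤ D≤wt-⊖ ⟩
        ℕ∑.sum (λ t → CL.wt (c′ ⊖[ from t ] c)) ≤⟨ sum-wt-⊖≤ c c′ μ c′≡μc ⟩
        CL.wt c ℕ.* (q ∸ 1)                     ≤⟨ ℕₚ.*-monoˡ-≤ (q ∸ 1) (proj₂ C-maxWt c Cc) ⟩
        W ℕ.* (q ∸ 1)                           ≡⟨ ℕₚ.*-comm W (q ∸ 1) ⟩
        (q ∸ 1) ℕ.* W                           ∎
        where open ℕₚ.≤-Reasoning

  module _ {n} (π : L.Carrier → CF.Vec n) (π-linear : IsFLinear π) (π-injective : IsInjective π) where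
    π-+ : ∀ x y l → π (x L.+ y) l ≡ π x l F.+ π y l
    π-+ = proj₁ π-linear

    π-scale : ∀ a x l → π (ι a L.* x) l ≡ a F.* π x l
    π-scale = proj₂ π-linear

    π-0 : ∀ l → π L.0# l ≡ F.0#
    π-0 l = x+x≈x⇒x≈0 _ (trans (sym (π-+ L.0# L.0# l)) (cong (λ x → π x l) (RL.+-identityˡ L.0#)))

    π-sum : ∀ {m} (f : Vector L.Carrier m) l → π (VL.sum f) l ≡ VF.sum (λ i → π (f i) l)
    π-sum {zero}  f l = π-0 l
    π-sum {suc m} f l = trans (π-+ _ _ l) (cong (π (f zero) l F.+_) (π-sum (f ∘ suc) l))

    π-kernel : ∀ x → π x CF.≗ᵥ CF.0ᵥ → x ≡ L.0#
    π-kernel x πx≗0 = π-injective x L.0# (λ l → trans (πx≗0 l) (sym (π-0 l)))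

    concatWord-kernel : ∀ {N} (c : CL.Vec N) → concatWord π c CF.≗ᵥ CF.0ᵥ → c CL.≗ᵥ CL.0ᵥ
    concatWord-kernel c c↦0 j =
      π-kernel (c j) (λ l → trans (sym (concatWord-combine π c j l)) (c↦0 (combine j l)))

    concatWord-scale : ∀ {N} {c c′ : CL.Vec N} a → (∀ j → c′ j ≡ ι a L.* c j) →
                       concatWord π c′ CF.≗ᵥ (a CF.• concatWord π c)
    concatWord-scale {N} {c} a c′≡ac r = trans (cong (λ x → π x l) (c′≡ac j)) (π-scale a (c j) l)
      where
      j = proj₁ (remQuot {N} n r)
      l = proj₂ (remQuot {N} n r)

    module _ {I : CF.Code n} (π-image : HasImage π I) where
      π∈I : ∀ x → I (π x)
      π∈I = proj₂ π-image

      module _ {k} (I-linear : CF.IsLinearCode I k) where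
        open VF.LinearCode I-linear renaming (generator to G)

        basis : Fin k → L.Carrier
        basis t = proj₁ (proj₁ π-image (VF.unit t CF.·ₘ G) (contains (VF.unit t)))

        π-basis : ∀ t l → π (basis t) l ≡ G t l
        π-basis t l = trans (sym (proj₂ (proj₁ π-image _ (contains (VF.unit t))) l)) (VF.·ₘ-unit G t l)

        combination : CF.Vec k → L.Carrier
        combination a = VL.sum (λ t → ι (a t) L.* basis t)

        combination-cong : ∀ {a b} → a CF.≗ᵥ b → combination a ≡ combination b
        combination-cong a≗b = VL.sum-cong-≗ (λ t → cong (λ x → ι x L.* basis t) (a≗b t))

        π-combination : ∀ a → π (combination a) CF.≗ᵥ (a CF.·ₘ G)
        π-combination a l = begin
          π (combination a) l                       ≡⟨ π-sum (λ t → ι (a t) L.* basis t) l ⟩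
          VF.sum (λ t → π (ι (a t) L.* basis t) l)  ≡⟨ VF.sum-cong-≗ term ⟩
          VF.sum (λ t → a t F.* G t l)              ≡⟨ VF.·ₘ≡sum a G l ⟨
          (a CF.·ₘ G) l                             ∎
          where
          open ≡-Reasoning
          term : ∀ t → π (ι (a t) L.* basis t) l ≡ a t F.* G t l
          term t = trans (π-scale (a t) (basis t) l) (cong (a t F.*_) (π-basis t l))

        π-combination-* : ∀ a y l →
                          π (combination a L.* y) l ≡ VF.sum (λ t → a t F.* π (basis t L.* y) l)
        π-combination-* a y l = begin
          π (combination a L.* y) l                ≡⟨ cong (λ x → π x l) (VL.*-distribʳ-sum y summand) ⟩
          π (VL.sum (λ t → summand t L.* y)) l     ≡⟨ π-sum (λ t → summand t L.* y) l ⟩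
          VF.sum (λ t → π (summand t L.* y) l)     ≡⟨ VF.sum-cong-≗ term ⟩
          VF.sum (λ t → a t F.* π (basis t L.* y) l) ∎
          where
          open ≡-Reasoning
          summand : Vector L.Carrier k
          summand t = ι (a t) L.* basis t
          term : ∀ t → π (summand t L.* y) l ≡ a t F.* π (basis t L.* y) l
          term t = trans (cong (λ x → π x l) (RL.*-assoc (ι (a t)) (basis t) y)) (π-scale (a t) (basis t L.* y) l)

        combination-surjective : ∀ y → ∃[ a ] (combination a ≡ y)
        combination-surjective y with spans (π y) (π∈I y)
        ... | a , πy≗aG = a , π-injective _ _ (λ l → trans (π-combination a l) (sym (πy≗aG l)))

        combination-kernel : ∀ a → combination a ≡ L.0# → a CF.≗ᵥ CF.0ᵥ
        combination-kernel a a↦0 =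
          independent a (λ l → trans (sym (π-combination a l)) (trans (cong (λ x → π x l) a↦0) (π-0 l)))

        module _ {N K} {C : CL.Code N} (C-linear : CL.IsLinearCode C K) where
          private
            module C = VL.LinearCode C-linear

          expand : CF.Vec (K ℕ.* k) → CL.Vec K
          expand x i = combination (λ t → x (combine i t))

          generatorRow : Fin K → Fin k → CF.Vec (N ℕ.* n)
          generatorRow i t = concatWord π (λ j → basis t L.* C.generator i j)

          concatGenerator : Fin (K ℕ.* k) → CF.Vec (N ℕ.* n)
          concatGenerator r = uncurry generatorRow (remQuot {K} k r)

          ·ₘ-concatGenerator : ∀ x →
                               (x CF.·ₘ concatGenerator) CF.≗ᵥ concatWord π (expand x CL.·ₘ C.generator)
          ·ₘ-concatGenerator x r = begin
            (x CF.·ₘ concatGenerator) r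
              ≡⟨ VF.·ₘ≡sum x concatGenerator r ⟩
            VF.sum (λ s → x s F.* concatGenerator s r)
              ≡⟨ VF.sum-combine K (λ s → x s F.* concatGenerator s r) ⟩
            VF.sum (λ i → VF.sum (λ t → x (combine {K} {k} i t) F.* concatGenerator (combine i t) r))
              ≡⟨ VF.sum-cong-≗ (λ i → VF.sum-cong-≗ (λ t → cong (x (combine i t) F.*_) (row i t))) ⟩
            VF.sum (λ i → VF.sum (λ t → x (combine {K} {k} i t) F.* π (basis t L.* C.generator i j) l))
              ≡⟨ VF.sum-cong-≗ (λ i → π-combination-* (λ t → x (combine i t)) (C.generator i j) l) ⟨
            VF.sum (λ i → π (expand x i L.* C.generator i j) l)
              ≡⟨ π-sum (λ i → expand x i L.* C.generator i j) l ⟨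
            π (VL.sum (λ i → expand x i L.* C.generator i j)) l
              ≡⟨ cong (λ y → π y l) (VL.·ₘ≡sum (expand x) C.generator j) ⟨
            concatWord π (expand x CL.·ₘ C.generator) r
              ∎
            where
            open ≡-Reasoning
            j = proj₁ (remQuot {N} n r)
            l = proj₂ (remQuot {N} n r)
            row : ∀ i t → concatGenerator (combine i t) r ≡ generatorRow i t r
            row i t = cong (λ (i′ , t′) → generatorRow i′ t′ r) (remQuot-combine {K} {k} i t)

          expand-surjective : ∀ y → ∃[ x ] (y CL.≗ᵥ expand x)
          expand-surjective y =
            x , λ i → sym (trans (combination-cong (x-combine i)) (proj₂ (combination-surjective (y i))))
            where
            a : Fin K → CF.Vec k
            a i = proj₁ (combination-surjective (y i))
            x : CF.Vec (K ℕ.* k)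
            x r = uncurry a (remQuot {K} k r)
            x-combine : ∀ i t → x (combine i t) ≡ a i t
            x-combine i t = cong (uncurry a) (remQuot-combine {K} {k} i t)

          expand-kernel : ∀ x → expand x CL.≗ᵥ CL.0ᵥ → x CF.≗ᵥ CF.0ᵥ
          expand-kernel x x↦0 r =
            trans (cong x (sym (combine-remQuot {K} k r))) (uncurry vanish (remQuot {K} k r))
            where
            vanish : ∀ i t → x (combine i t) ≡ F.0#
            vanish i = combination-kernel (λ t → x (combine i t)) (x↦0 i)

          concat-isLinearCode : CF.IsLinearCode (ConcatCode π C) (K ℕ.* k)
          concat-isLinearCode = concatGenerator , spans′ , contains′ , independent′
            where
            spans′ : ∀ v → ConcatCode π C v → ∃[ x ] (v CF.≗ᵥ (x CF.·ₘ concatGenerator))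
            spans′ v (c , Cc , v≗c) with C.spans c Cc
            ... | y , c≗yG with expand-surjective y
            ...   | x , y≗x = x , λ r → begin
              v r                                          ≡⟨ v≗c r ⟩
              concatWord π c r                             ≡⟨ concatWord-cong π c≗xG r ⟩
              concatWord π (expand x CL.·ₘ C.generator) r  ≡⟨ ·ₘ-concatGenerator x r ⟨
              (x CF.·ₘ concatGenerator) r                  ∎
              where
              open ≡-Reasoning
              c≗xG : c CL.≗ᵥ (expand x CL.·ₘ C.generator)
              c≗xG j = trans (c≗yG j) (VL.·ₘ-congˡ C.generator y≗x j)

            contains′ : ∀ x → ConcatCode π C (x CF.·ₘ concatGenerator)
            contains′ x = expand x CL.·ₘ C.generator , C.contains (expand x) , ·ₘ-concatGenerator x

            independent′ : ∀ x → (x CF.·ₘ concatGenerator) CF.≗ᵥ CF.0ᵥ → x CF.≗ᵥ CF.0ᵥ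
            independent′ x x↦0 = expand-kernel x (C.independent (expand x) (concatWord-kernel _ expand↦0))
              where
              expand↦0 : concatWord π (expand x CL.·ₘ C.generator) CF.≗ᵥ CF.0ᵥ
              expand↦0 r = trans (sym (·ₘ-concatGenerator x r)) (x↦0 r)

      module _ {d} (I-dist : CF.HasMinDistance I d) where
        d≤wt-π : ∀ x → VL.wt₁ x ℕ.* d ≤ CF.wt (π x)
        d≤wt-π x with x L.≟ L.0#
        ... | yes _   = z≤n
        ... | no  x≢0 =
          ℕₚ.≤-trans (ℕₚ.≤-reflexive (ℕₚ.+-identityʳ d)) (proj₂ I-dist (π x) (π∈I x) (x≢0 ∘ π-kernel x))

        wt*d≤wt-concatWord : ∀ {N} (c : CL.Vec N) → CL.wt c ℕ.* d ≤ CF.wt (concatWord π c)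
        wt*d≤wt-concatWord c = begin
          CL.wt c ℕ.* d                          ≡⟨ cong (ℕ._* d) (VL.wt≡sum-wt₁ c) ⟩
          ℕ∑.sum (VL.wt₁ ∘ c) ℕ.* d              ≡⟨ ℕ∑.*-distribʳ-sum d (VL.wt₁ ∘ c) ⟩
          ℕ∑.sum (λ j → VL.wt₁ (c j) ℕ.* d)      ≤⟨ ℕ∑.sum-mono-≤ (d≤wt-π ∘ c) ⟩
          ℕ∑.sum (λ j → CF.wt (π (c j)))         ≡⟨ wt-concatWord π c ⟨
          CF.wt (concatWord π c)                 ∎
          where open ℕₚ.≤-Reasoning

        concat-minDistance : ∀ {N D} {C : CL.Code N} → CL.HasMinDistance C D →
                             ∀ v → ConcatCode π C v → CF.Nonzero v → D ℕ.* d ≤ CF.wt v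
        concat-minDistance {D = D} C-dist v (c , Cc , v≗c) v≢0 = begin
          D ℕ.* d                  ≤⟨ ℕₚ.*-monoˡ-≤ d (proj₂ C-dist c Cc c≢0) ⟩
          CL.wt c ℕ.* d            ≤⟨ wt*d≤wt-concatWord c ⟩
          CF.wt (concatWord π c)   ≡⟨ VF.wt-cong v≗c ⟨
          CF.wt v                  ∎
          where
          open ℕₚ.≤-Reasoning
          c≢0 : CL.Nonzero c
          c≢0 c≗0 = v≢0 (λ r → trans (v≗c r) (trans (cong (λ x → π x _) (c≗0 _)) (π-0 _)))

      module _ (I-minimal : CF.IsMinimalCode I) where
        π-coordinatewise-multiple : ∀ {N} {c c′ : CL.Vec N} → concatWord π c′ CF.⊆σ concatWord π c →
                                    ∀ j → ∃[ μ ] (c′ j ≡ ι μ L.* c j)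
        π-coordinatewise-multiple {c = c} {c′} c′⊆c j with c′ j L.≟ L.0#
        ... | yes c′j≡0 = F.0# , trans c′j≡0 (sym (trans (cong (L._* c j) ι-0) (RL.zeroˡ (c j))))
        ... | no  c′j≢0 = μ , π-injective _ _ (λ l → trans (πc′≗μπc l) (sym (π-scale μ (c j) l)))
          where
          block : π (c′ j) CF.⊆σ π (c j)
          block = concatWord-⊆σ π c′⊆c j
          πc′≢0 : CF.Nonzero (π (c′ j))
          πc′≢0 = c′j≢0 ∘ π-kernel (c′ j)
          πc≢0 : CF.Nonzero (π (c j))
          πc≢0 = πc′≢0 ∘ VF.⊆σ-zero block
          minimal = I-minimal (π (c j)) (π∈I (c j)) πc≢0 (π (c′ j)) (π∈I (c′ j)) πc′≢0 block
          μ = proj₁ minimal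
          πc′≗μπc = proj₂ (proj₂ minimal)

        concat-isMinimal : ∀ {N} {C : CL.Code N} → ScalarRigid C → CF.IsMinimalCode (ConcatCode π C)
        concat-isMinimal C-rigid v (c , Cc , v≗c) _ v′ (c′ , Cc′ , v′≗c′) v′≢0 v′⊆v = a , a≢0 , v′≗av
          where
          c′⊆c : concatWord π c′ CF.⊆σ concatWord π c
          c′⊆c r c′r≢0 cr≡0 = v′⊆v r (c′r≢0 ∘ trans (sym (v′≗c′ r))) (trans (v≗c r) cr≡0)
          coordinatewise = π-coordinatewise-multiple c′⊆c
          multiple = C-rigid Cc Cc′ (λ j → proj₁ (coordinatewise j)) (λ j → proj₂ (coordinatewise j))
          a = proj₁ multiple
          v′≗av : v′ CF.≗ᵥ (a CF.• v)
          v′≗av r =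
            trans (v′≗c′ r) (trans (concatWord-scale a (proj₂ multiple) r) (cong (a F.*_) (sym (v≗c r))))
          a≢0 : a ≢ F.0#
          a≢0 a≡0 = v′≢0 (λ r → trans (v′≗av r) (trans (cong (F._* v r) a≡0) (RF.zeroˡ (v r))))

open import Data.Nat using (_*_)

mainTheorem1 : (q k N K n D W d : ℕ) → (F L : Field) → (E : FieldEmbedding F L) → IsPrimePower q → 1 ≤ k → 1 ≤ N → 1 ≤ K → 1 ≤ n → HasSize F q → HasSize L (q ^ k) → (C : Coding.Code L N) → Coding.IsLinearCode L C K → Coding.HasMinDistance L C D → Coding.HasMaxWeight L C W → (q ∸ 1) * W < q * D → (I : Coding.Code F n) → Coding.IsLinearCode F I k → Coding.HasMinDistance F I d → Coding.IsMinimalCode F I → (π : Field.Carrier L → Coding.Vec F n) → Concat.IsFLinear E π → Concat.IsInjective E π → Concat.HasImage E π I → Coding.IsLinearCode F (Concat.ConcatCode E π C) (K * k) × Coding.IsMinimalCode F (Concat.ConcatCode E π C) × (∀ v → Concat.ConcatCode E π C v → Coding.Nonzero F v → D * d ≤ Coding.wt F v)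
mainTheorem1 q k N K n D W d F L E _ _ _ _ _ F-size _ C C-linear C-dist C-maxWt ratio I I-linear I-dist I-minimal π π-linear π-injective π-image =
    concat-isLinearCode π π-linear π-injective π-image I-linear C-linear
  , concat-isMinimal π π-linear π-injective π-image I-minimal (scalarRigid F-size C-linear C-dist C-maxWt ratio)
  , concat-minDistance π π-linear π-injective π-image I-dist C-dist
  where open Concatenation E
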